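{- Let $M_h$ be a model of a high-level BAT $\mathcal{D}_h$ and $M_l$ a model of $\mathcal{D}_l\cup\mathcal{C}$ for a low-level BAT $\mathcal{D}_l$, let $m$ be a refinement mapping from $\mathcal{D}_h$ to $\mathcal{D}_l$, and suppose $M_h\sim_m M_l$. Then for any sequence $\vec\alpha$ of high-level actions and any variable assignment $v$: (i) if $s_l$ is a situation of $M_l$ with $M_l,v[s'/s_l]\models Do(m(\vec\alpha),S_0,s')$, then there exists a situation $s_h$ of $M_h$ such that $M_h,v[s'/s_h]\models s'=do(\vec\alpha,S_0)\land Executable(s')$ and $s_h\sim_m^{M_h,M_l}s_l$; and (ii) if $s_h$ is a situation of $M_h$ with $M_h,v[s'/s_h]\models s'=do(\vec\alpha,S_0)\land Executable(s')$, then there exists a situation $s_l$ of $M_l$ such that $M_l,v[s'/s_l]\models Do(m(\vec\alpha),S_0,s')$ and $s_h\sim_m^{M_h,M_l}s_l$.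
   Context: Situation calculus setting. Objects are a countably infinite set $\mathcal{N}$ of standard names (unique names and domain closure); no function symbols other than constants; no non-fluent predicates. Situations: $S_0$ and $do(a,s)$; $do([a_1,\dots,a_n],s)$ abbreviates $do(a_n,\dots,do(a_1,s)\dots)$, also written $do(\vec a,s)$. $Poss(a,s)$ means $a$ is executable in $s$; $Executable(s)$ means every action along the history from $S_0$ to $s$ was possible where performed. A basic action theory (BAT) over finitely many action types $\mathcal{A}$ and fluents $\mathcal{F}$ consists of initial-state axioms $\mathcal{D}_{S_0}$, precondition axioms $Poss(A(\vec x),s)\equiv\phi^{Poss}_A(\vec x,s)$, successor state axioms $F(\vec x,do(a,s))\equiv\phi^{ssa}_F(\vec x,a,s)$ (right-hand sides uniform in $s$), unique names/domain closure axioms for actions $\mathcal{D}_{ca}$ and for objects $\mathcal{D}_{coa}$, and foundational axioms $\Sigma$. A situation-suppressed formula omits situation arguments of fluents; $\phi[s]$ restores $s$. ConGolog programs $\delta::=\alpha\mid\varphi?\mid\delta_1;\delta_2\mid\delta_1|\delta_2\mid\pi x.\delta\mid\delta^*\mid\delta_1\|\delta_2$, $nil=True?$; $\mathcal{C}$ are the axioms: $Trans(\alpha,s,\delta',s')\equiv s'=do(\alpha,s)\land Poss(\alpha,s)\land\delta'=True?$; $Trans(\varphi?,s,\delta',s')\equiv False$; $Trans(\delta_1;\delta_2,s,\delta',s')\equiv\exists\delta_1'(Trans(\delta_1,s,\delta_1',s')\land\delta'=\delta_1';\delta_2)\lor(Final(\delta_1,s)\land Trans(\delta_2,s,\delta',s'))$;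 $Trans(\delta_1|\delta_2,\cdot)\equiv Trans(\delta_1,\cdot)\lor Trans(\delta_2,\cdot)$; $Trans(\pi x.\delta,s,\delta',s')\equiv\exists x.Trans(\delta,s,\delta',s')$; $Trans(\delta^*,s,\delta',s')\equiv\exists\delta''(Trans(\delta,s,\delta'',s')\land\delta'=\delta'';\delta^*)$; $Trans(\delta_1\|\delta_2,s,\delta',s')\equiv\exists\delta_1'(Trans(\delta_1,s,\delta_1',s')\land\delta'=\delta_1'\|\delta_2)\lor\exists\delta_2'(Trans(\delta_2,s,\delta_2',s')\land\delta'=\delta_1\|\delta_2')$; $Final(\alpha,s)\equiv False$; $Final(\varphi?,s)\equiv\varphi[s]$; $Final(\delta_1;\delta_2,s)\equiv Final(\delta_1,s)\land Final(\delta_2,s)$; $Final(\delta_1|\delta_2,s)\equiv Final(\delta_1,s)\lor Final(\delta_2,s)$; $Final(\pi x.\delta,s)\equiv\exists x.Final(\delta,s)$; $Final(\delta^*,s)\equiv True$; $Final(\delta_1\|\delta_2,s)\equiv Final(\delta_1,s)\land Final(\delta_2,s)$. $Do(\delta,s,s')\doteq\exists\delta'.Trans^*(\delta,s,\delta',s')\land Final(\delta',s')$, $Trans^*$ the reflexive transitive closure. $\mathcal{D}_h$, $\mathcal{D}_l$ have action types $\mathcal{A}_h,\mathcal{A}_l$ and fluents $\mathcal{F}_h,\mathcal{F}_l$, sharing only $\mathcal{N}$. A refinement mapping $m$ maps each $A\in\mathcal{A}_h$ to a situation-determined ConGolog program $m(A(\vec x))$ over $\mathcal{D}_l$ with free variables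 $\vec x$ (situation-determined: the remaining program after any sequence of transitions is determined by the resulting situation), and each $F\in\mathcal{F}_h$ to a situation-suppressed low-level formula $m(F(\vec x))$; $m(\alpha_1,\dots,\alpha_n)=m(\alpha_1);\dots;m(\alpha_n)$, $m(\epsilon)=nil$. $s_h\simeq_m^{M_h,M_l}s_l$ ($m$-isomorphic) iff for all $F\in\mathcal{F}_h$ and assignments $v$, $M_h,v[s/s_h]\models F(\vec x,s)$ iff $M_l,v[s/s_l]\models m(F(\vec x))[s]$. A relation $B$ between situation domains of $M_h$ and $M_l$ is an $m$-bisimulation if each $\langle s_h,s_l\rangle\in B$ satisfies: (1) $s_h\simeq_m^{M_h,M_l}s_l$; (2) for each $A\in\mathcal{A}_h$ and $v$, if some $s_h'$ has $M_h,v[s/s_h,s'/s_h']\models Poss(A(\vec x),s)\land s'=do(A(\vec x),s)$ then some $s_l'$ has $M_l,v[s/s_l,s'/s_l']\models Do(m(A(\vec x)),s,s')$ and $\langle s_h',s_l'\rangle\in B$; (3) for each $A\in\mathcal{A}_h$ and $v$, if some $s_l'$ has $M_l,v[s/s_l,s'/s_l']\models Do(m(A(\vec x)),s,s')$ then some $s_h'$ has $M_h,v[s/s_h,s'/s_h']\models Poss(A(\vec x),s)\land s'=do(A(\vec x),s)$ and $\langle s_h',s_l'\rangle\in B$. $M_h\sim_m M_l$ iff some $m$-bisimulation contains $\langle S_0^{M_h},S_0^{M_l}\rangle$; $s_h\sim_m^{M_h,M_l}s_l$ iff some $m$-bisimulation contains $\langle s_h,s_l\rangle$. -}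

module Defs where

open import Data.Nat using (ℕ)
open import Data.Fin using (Fin)
open import Data.Vec using (Vec)
open import Data.List using (List; []; _∷_)
open import Data.Product using (Σ; _×_; _,_)
open import Data.Sum using (_⊎_)
open import Data.Unit using (⊤)
open import Data.Empty using (⊥)
open import Relation.Nullary using (¬_)
open import Relation.Binary.PropositionalEquality using (_≡_)

_⇔_ : Set → Set → Set
P ⇔ Q = (P → Q) × (Q → P)

-- Signatures: finitely many action types and fluents, each with an
-- arity.  Objects are the standard names, represented by ℕ.

record Sig : Set where
  field
    nAct     : ℕ
    actArity : Fin nAct → ℕ
    nFlu     : ℕ
    fluArity : Fin nFlu → ℕ
open Sig public

-- Ground actions A(n⃗) (unique names and domain closure for actions).
Action : Sig → Set
Action σ = Σ (Fin (nAct σ)) (λ A → Vec ℕ (actArity σ A))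

-- Situations: S0 and doₛ(a,s) (foundational axioms Σ).
data Sit (σ : Sig) : Set where
  S0 : Sit σ
  doₛ : Action σ → Sit σ → Sit σ

doSeq : {σ : Sig} → List (Action σ) → Sit σ → Sit σ
doSeq []       s = s
doSeq (a ∷ as) s = doSeq as (doₛ a s)

-- Situation-suppressed first-order formulas (higher-order abstract
-- syntax: free object variables are Agda variables, quantifiers bind
-- Agda functions).

data Form (σ : Sig) : Set where
  fl    : (F : Fin (nFlu σ)) → Vec ℕ (fluArity σ F) → Form σ
  eqO   : ℕ → ℕ → Form σ
  eqA   : Action σ → Action σ → Form σ
  true  : Form σ
  neg   : Form σ → Form σ
  conj  : Form σ → Form σ → Form σ
  disj  : Form σ → Form σ → Form σ
  exO   : (ℕ → Form σ) → Form σ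
  allO  : (ℕ → Form σ) → Form σ
  exA   : (Action σ → Form σ) → Form σ
  allA  : (Action σ → Form σ) → Form σ

record Structure (σ : Sig) : Set₁ where
  field
    Holds : (F : Fin (nFlu σ)) → Vec ℕ (fluArity σ F) → Sit σ → Set
    Poss  : Action σ → Sit σ → Set
open Structure public

⟦_⟧ : {σ : Sig} → Form σ → Structure σ → Sit σ → Set
⟦ fl F xs ⟧ M s  = Holds M F xs s
⟦ eqO x y ⟧ M s  = x ≡ y
⟦ eqA a b ⟧ M s  = a ≡ b
⟦ true ⟧ M s     = ⊤
⟦ neg φ ⟧ M s    = ¬ (⟦ φ ⟧ M s)
⟦ conj φ ψ ⟧ M s = ⟦ φ ⟧ M s × ⟦ ψ ⟧ M s
⟦ disj φ ψ ⟧ M s = ⟦ φ ⟧ M s ⊎ ⟦ ψ ⟧ M s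
⟦ exO φ ⟧ M s    = Σ ℕ (λ x → ⟦ φ x ⟧ M s)
⟦ allO φ ⟧ M s   = (x : ℕ) → ⟦ φ x ⟧ M s
⟦_⟧ {σ} (exA φ) M s = Σ (Action σ) (λ a → ⟦ φ a ⟧ M s)
⟦_⟧ {σ} (allA φ) M s = (a : Action σ) → ⟦ φ a ⟧ M s

record BAT (σ : Sig) : Set₁ where
  field
    Init   : Form σ → Set
    PossAx : (A : Fin (nAct σ)) → Vec ℕ (actArity σ A) → Form σ
    SSA    : (F : Fin (nFlu σ)) → Vec ℕ (fluArity σ F) → Action σ → Form σ
open BAT public

record IsModel {σ : Sig} (D : BAT σ) (M : Structure σ) : Set where
  field
    init : ∀ φ → Init D φ → ⟦ φ ⟧ M S0
    poss : ∀ A xs s → Poss M (A , xs) s ⇔ ⟦ PossAx D A xs ⟧ M s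
    ssa  : ∀ F xs a s → Holds M F xs (doₛ a s) ⇔ ⟦ SSA D F xs a ⟧ M s

Executable : {σ : Sig} → Structure σ → Sit σ → Set
Executable M S0       = ⊤
Executable M (doₛ a s) = Executable M s × Poss M a s

data Prog (σ : Sig) : Set where
  act  : Action σ → Prog σ
  test : Form σ → Prog σ
  _⨟_  : Prog σ → Prog σ → Prog σ
  _∣_  : Prog σ → Prog σ → Prog σ
  pi   : (ℕ → Prog σ) → Prog σ
  star : Prog σ → Prog σ
  _∥_  : Prog σ → Prog σ → Prog σ

nil : {σ : Sig} → Prog σ
nil = test true

Final : {σ : Sig} → Structure σ → Prog σ → Sit σ → Set
Final M (act a)   s = ⊥
Final M (test φ)  s = ⟦ φ ⟧ M s
Final M (δ₁ ⨟ δ₂) s = Final M δ₁ s × Final M δ₂ s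
Final M (δ₁ ∣ δ₂) s = Final M δ₁ s ⊎ Final M δ₂ s
Final M (pi δ)    s = Σ ℕ (λ x → Final M (δ x) s)
Final M (star δ)  s = ⊤
Final M (δ₁ ∥ δ₂) s = Final M δ₁ s × Final M δ₂ s

Trans : {σ : Sig} → Structure σ → Prog σ → Sit σ → Prog σ → Sit σ → Set
Trans M (act a)   s δ' s' = (s' ≡ doₛ a s) × Poss M a s × (δ' ≡ nil)
Trans M (test φ)  s δ' s' = ⊥
Trans M (δ₁ ⨟ δ₂) s δ' s' =
  Σ (Prog _) (λ δ₁' → Trans M δ₁ s δ₁' s' × (δ' ≡ (δ₁' ⨟ δ₂)))
  ⊎ (Final M δ₁ s × Trans M δ₂ s δ' s')
Trans M (δ₁ ∣ δ₂) s δ' s' = Trans M δ₁ s δ' s' ⊎ Trans M δ₂ s δ' s'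
Trans M (pi δ)    s δ' s' = Σ ℕ (λ x → Trans M (δ x) s δ' s')
Trans M (star δ)  s δ' s' =
  Σ (Prog _) (λ δ'' → Trans M δ s δ'' s' × (δ' ≡ (δ'' ⨟ star δ)))
Trans M (δ₁ ∥ δ₂) s δ' s' =
  Σ (Prog _) (λ δ₁' → Trans M δ₁ s δ₁' s' × (δ' ≡ (δ₁' ∥ δ₂)))
  ⊎ Σ (Prog _) (λ δ₂' → Trans M δ₂ s δ₂' s' × (δ' ≡ (δ₁ ∥ δ₂')))

data Trans* {σ : Sig} (M : Structure σ) : Prog σ → Sit σ → Prog σ → Sit σ → Set where
  ε   : ∀ {δ s} → Trans* M δ s δ s
  _◅_ : ∀ {δ s δ₁ s₁ δ' s'} → Trans M δ s δ₁ s₁ → Trans* M δ₁ s₁ δ' s' → Trans* M δ s δ' s'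

Do : {σ : Sig} → Structure σ → Prog σ → Sit σ → Sit σ → Set
Do M δ s s' = Σ (Prog _) (λ δ' → Trans* M δ s δ' s' × Final M δ' s')

SitDetermined : {σ : Sig} → Structure σ → Prog σ → Sit σ → Set
SitDetermined M δ s =
  ∀ s' δ' δ'' → Trans* M δ s δ' s' → Trans* M δ s δ'' s' → δ' ≡ δ''

record Refinement (σh σl : Sig) : Set where
  field
    prog : (A : Fin (nAct σh)) → Vec ℕ (actArity σh A) → Prog σl
    form : (F : Fin (nFlu σh)) → Vec ℕ (fluArity σh F) → Form σl
open Refinement public

IsRefinement : {σh σl : Sig} → BAT σl → Refinement σh σl → Set₁
IsRefinement {σh} {σl} Dl m =
  (M : Structure σl) → IsModel Dl M →
  ∀ A xs s → SitDetermined M (prog m A xs) s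

mapAct : {σh σl : Sig} → Refinement σh σl → Action σh → Prog σl
mapAct m (A , xs) = prog m A xs

mapSeq : {σh σl : Sig} → Refinement σh σl → List (Action σh) → Prog σl
mapSeq m []           = nil
mapSeq m (a ∷ [])     = mapAct m a
mapSeq m (a ∷ b ∷ as) = mapAct m a ⨟ mapSeq m (b ∷ as)

module _ {σh σl : Sig} (m : Refinement σh σl) (Mh : Structure σh) (Ml : Structure σl) where

  Iso : Sit σh → Sit σl → Set
  Iso sh sl = ∀ F xs → Holds Mh F xs sh ⇔ ⟦ form m F xs ⟧ Ml sl

  IsBisimulation : (Sit σh → Sit σl → Set) → Set
  IsBisimulation B = ∀ sh sl → B sh sl →
      Iso sh sl
    × (∀ A xs → Poss Mh (A , xs) sh →
         Σ (Sit σl) (λ sl' → Do Ml (prog m A xs) sl sl' × B (doₛ (A , xs) sh) sl'))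
    × (∀ A xs sl' → Do Ml (prog m A xs) sl sl' →
         Poss Mh (A , xs) sh × B (doₛ (A , xs) sh) sl')

  Bisimilar : Sit σh → Sit σl → Set₁
  Bisimilar sh sl =
    Σ (Sit σh → Sit σl → Set) (λ B → IsBisimulation B × B sh sl)

  BisimilarModels : Set₁
  BisimilarModels = Bisimilar S0 S0

-- A run of m(α);m(α⃗) passes through an
-- intermediate situation at which m(α) has finished and m(α⃗) starts, and
-- conversely two such runs compose. So a run of m(α⃗) is a chain of runs of the
-- single refinements m(αᵢ), and clauses (2) and (3) of an m-bisimulation match
-- each link with one high-level action while staying inside the bisimulation.
module Submission where

open import Defs
open import Data.List using (List; []; _∷_)
open import Data.Product using (Σ; _×_; _,_; proj₁; proj₂)
open import Data.Sum using (inj₁; inj₂)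
open import Data.Unit using (tt)
open import Relation.Binary.PropositionalEquality using (_≡_; refl)

module _ {σ : Sig} {M : Structure σ} where

  _◅◅_ : ∀ {δ s δ₁ s₁ δ' s'} →
         Trans* M δ s δ₁ s₁ → Trans* M δ₁ s₁ δ' s' → Trans* M δ s δ' s'
  ε       ◅◅ q = q
  (t ◅ p) ◅◅ q = t ◅ (p ◅◅ q)

  Trans*-⨟ˡ : ∀ {δ₁ δ₂ s δ₁' s'} →
              Trans* M δ₁ s δ₁' s' → Trans* M (δ₁ ⨟ δ₂) s (δ₁' ⨟ δ₂) s'
  Trans*-⨟ˡ ε       = ε
  Trans*-⨟ˡ (t ◅ r) = inj₁ (_ , t , refl) ◅ Trans*-⨟ˡ r

  Do-nil : ∀ {s} → Do M nil s s
  Do-nil = nil , ε , tt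

  Do-nil⁻ : ∀ {s s'} → Do M nil s s' → s' ≡ s
  Do-nil⁻ (_ , ε , _)     = refl
  Do-nil⁻ (_ , () ◅ _ , _)

  Do-⨟ : ∀ {δ₁ δ₂ s s'' s'} → Do M δ₁ s s'' → Do M δ₂ s'' s' → Do M (δ₁ ⨟ δ₂) s s'
  Do-⨟ {δ₂ = δ₂} (δ₁' , r₁ , f₁) (_ , ε , f₂)      = δ₁' ⨟ δ₂ , Trans*-⨟ˡ r₁ , f₁ , f₂
  Do-⨟           (_ , r₁ , f₁)   (δ₂' , t ◅ r₂ , f₂) =
    δ₂' , Trans*-⨟ˡ r₁ ◅◅ (inj₂ (f₁ , t) ◅ r₂) , f₂

  Trans*-⨟⁻ : ∀ {δ₁ δ₂ s δ' s'} → Trans* M (δ₁ ⨟ δ₂) s δ' s' → Final M δ' s' →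
              Σ (Sit σ) (λ s'' → Do M δ₁ s s'' × Do M δ₂ s'' s')
  Trans*-⨟⁻ ε (f₁ , f₂) = _ , (_ , ε , f₁) , (_ , ε , f₂)
  Trans*-⨟⁻ (inj₁ (_ , t , refl) ◅ r) f with Trans*-⨟⁻ r f
  ... | s'' , (δ₁' , r₁ , f₁) , d₂ = s'' , (δ₁' , t ◅ r₁ , f₁) , d₂
  Trans*-⨟⁻ (inj₂ (f₁ , t) ◅ r) f = _ , (_ , ε , f₁) , (_ , t ◅ r , f)

  Do-⨟⁻ : ∀ {δ₁ δ₂ s s'} → Do M (δ₁ ⨟ δ₂) s s' →
          Σ (Sit σ) (λ s'' → Do M δ₁ s s'' × Do M δ₂ s'' s')
  Do-⨟⁻ (_ , r , f) = Trans*-⨟⁻ r f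

module _ {σh σl : Sig} (m : Refinement σh σl) {M : Structure σl} where

  Do-mapSeq-∷ : ∀ {a as s s' s''} →
                Do M (mapAct m a) s s' → Do M (mapSeq m as) s' s'' →
                Do M (mapSeq m (a ∷ as)) s s''
  Do-mapSeq-∷ {as = []}    d₁ d₂ with Do-nil⁻ d₂
  ... | refl = d₁
  Do-mapSeq-∷ {as = _ ∷ _} d₁ d₂ = Do-⨟ d₁ d₂

  Do-mapSeq-∷⁻ : ∀ {a as s s''} → Do M (mapSeq m (a ∷ as)) s s'' →
                 Σ (Sit σl) (λ s' → Do M (mapAct m a) s s' × Do M (mapSeq m as) s' s'')
  Do-mapSeq-∷⁻ {as = []}    d = _ , d , Do-nil
  Do-mapSeq-∷⁻ {as = _ ∷ _} d = Do-⨟⁻ d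

Executable-doSeq⁻ : ∀ {σ} {M : Structure σ} as s → Executable M (doSeq as s) → Executable M s
Executable-doSeq⁻ []       s e = e
Executable-doSeq⁻ (a ∷ as) s e = proj₁ (Executable-doSeq⁻ as (doₛ a s) e)

module _ {σh σl : Sig} (m : Refinement σh σl) (Mh : Structure σh) (Ml : Structure σl)
         {B : Sit σh → Sit σl → Set} (isB : IsBisimulation m Mh Ml B) where

  step-forth : ∀ {sh sl A xs} → B sh sl → Poss Mh (A , xs) sh →
               Σ (Sit σl) (λ sl' → Do Ml (prog m A xs) sl sl' × B (doₛ (A , xs) sh) sl')
  step-forth {sh} {sl} {A} {xs} b = proj₁ (proj₂ (isB sh sl b)) A xs

  step-back : ∀ {sh sl A xs sl'} → B sh sl → Do Ml (prog m A xs) sl sl' →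
              Poss Mh (A , xs) sh × B (doₛ (A , xs) sh) sl'
  step-back {sh} {sl} {A} {xs} {sl'} b = proj₂ (proj₂ (isB sh sl b)) A xs sl'

  Do-mapSeq⇒doSeq : ∀ αs {sh sl sl'} → B sh sl → Executable Mh sh →
                    Do Ml (mapSeq m αs) sl sl' →
                    Σ (Sit σh) (λ sh' → (sh' ≡ doSeq αs sh) × Executable Mh sh' × B sh' sl')
  Do-mapSeq⇒doSeq [] {sh} b e d with Do-nil⁻ d
  ... | refl = sh , refl , e , b
  Do-mapSeq⇒doSeq (α ∷ αs) b e d with Do-mapSeq-∷⁻ m {a = α} {as = αs} d
  ... | _ , d₁ , d₂ with step-back b d₁
  ...   | p , b' = Do-mapSeq⇒doSeq αs b' (e , p) d₂

  doSeq⇒Do-mapSeq : ∀ αs {sh sl} → B sh sl → Executable Mh (doSeq αs sh) →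
                    Σ (Sit σl) (λ sl' → Do Ml (mapSeq m αs) sl sl' × B (doSeq αs sh) sl')
  doSeq⇒Do-mapSeq [] {sl = sl} b e = sl , Do-nil , b
  doSeq⇒Do-mapSeq (α ∷ αs) {sh} b e
    with step-forth b (proj₂ (Executable-doSeq⁻ αs (doₛ α sh) e))
  ... | _ , d₁ , b₁ with doSeq⇒Do-mapSeq αs b₁ e
  ...   | sl' , d₂ , b' = sl' , Do-mapSeq-∷ m {a = α} {as = αs} d₁ d₂ , b'

lemma2 : {σh σl : Sig} (Dh : BAT σh) (Dl : BAT σl)
         (Mh : Structure σh) (Ml : Structure σl) →
         IsModel Dh Mh → IsModel Dl Ml →
         (m : Refinement σh σl) → IsRefinement Dl m →
         BisimilarModels m Mh Ml →
         (αs : List (Action σh)) →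
           ((sl : Sit σl) → Do Ml (mapSeq m αs) S0 sl →
             Σ (Sit σh) (λ sh → (sh ≡ doSeq αs S0) × Executable Mh sh × Bisimilar m Mh Ml sh sl))
         × ((sh : Sit σh) → (sh ≡ doSeq αs S0) × Executable Mh sh →
             Σ (Sit σl) (λ sl → Do Ml (mapSeq m αs) S0 sl × Bisimilar m Mh Ml sh sl))
lemma2 _ _ Mh Ml _ _ m _ (B , isB , b₀) αs = low⇒high , high⇒low
  where
  low⇒high : (sl : Sit _) → Do Ml (mapSeq m αs) S0 sl →
             Σ (Sit _) (λ sh → (sh ≡ doSeq αs S0) × Executable Mh sh × Bisimilar m Mh Ml sh sl)
  low⇒high sl d with Do-mapSeq⇒doSeq m Mh Ml isB αs b₀ tt d
  ... | sh , eq , e , b = sh , eq , e , B , isB , b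

  high⇒low : (sh : Sit _) → (sh ≡ doSeq αs S0) × Executable Mh sh →
             Σ (Sit _) (λ sl → Do Ml (mapSeq m αs) S0 sl × Bisimilar m Mh Ml sh sl)
  high⇒low _ (refl , e) with doSeq⇒Do-mapSeq m Mh Ml isB αs b₀ e
  ... | sl , d , b = sl , d , B , isB , b
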